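{- Let $s$ be a positive integer. The circle graph $C$ on $6s+1$ vertices determined by the set $\{2s+1,2s+2,\ldots,3s\}$ has the property that every minimum cardinality vertex cover of $C$ contains at least $4s$ vertices.
   Context: For an integer $n\ge 2$ and a set $S\subseteq\{1,\ldots,\lfloor n/2\rfloor\}$, the circle graph on $n$ vertices determined by $S$ is the graph with vertex set $\{0,1,\ldots,n-1\}$ in which two vertices $x,y$ are adjacent if and only if $(x-y)\bmod n\in S$ or $(y-x)\bmod n\in S$. -}

module Defs where

open import Data.Nat using (ℕ; suc; _+_; _*_; _∸_; _≤_; NonZero)
open import Data.Nat.DivMod using (_%_)
open import Data.Fin using (Fin; toℕ)
open import Data.Fin.Subset using (Subset; _∈_; ∣_∣)
open import Data.Sum using (_⊎_)
open import Data.Product using (_×_)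

diffMod : (n : ℕ) → .{{NonZero n}} → Fin n → Fin n → ℕ
diffMod n x y = (toℕ x + n ∸ toℕ y) % n

CircleAdj : (n : ℕ) → .{{NonZero n}} → (ℕ → Set) → Fin n → Fin n → Set
CircleAdj n S x y = S (diffMod n x y) ⊎ S (diffMod n y x)

IsVertexCover : {n : ℕ} → (Fin n → Fin n → Set) → Subset n → Set
IsVertexCover {n} Adj K = ∀ (x y : Fin n) → Adj x y → x ∈ K ⊎ y ∈ K

IsMinVertexCover : {n : ℕ} → (Fin n → Fin n → Set) → Subset n → Set
IsMinVertexCover {n} Adj K =
  IsVertexCover Adj K × (∀ (K' : Subset n) → IsVertexCover Adj K' → ∣ K ∣ ≤ ∣ K' ∣)

Interval : ℕ → ℕ → Set
Interval s d = (2 * s + 1 ≤ d) × (d ≤ 3 * s)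

-- Let I be an independent set and m its least vertex. Two vertices at linear
-- distance e ∈ [2s+1, 4s] are adjacent (e or 6s+1−e lies in [2s+1, 3s]), so every
-- y ∈ I has offset y − m in [0, 2s] ∪ (4s, 6s], and no two elements of I have
-- offsets differing by exactly 4s. Hence y ↦ (y − m) mod 4s maps I injectively
-- into [0, 2s], so |I| ≤ 2s+1. The complement of a vertex cover is independent,
-- so a cover has at least (6s+1) − (2s+1) = 4s vertices.
module Submission where

open import Defs
open import Data.Nat using (ℕ; suc; _+_; _*_; _∸_; _≤_; _<_; _>_; z≤n; z<s; NonZero; >-nonZero; _≤?_; _<?_)
open import Data.Nat.Properties
  using ( module ≤-Reasoning; ≤-refl; ≤-trans; ≤-<-trans; ≤-pred; <⇒≤; ≮⇒≥; ≰⇒>; ≤ᵇ⇒≤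
        ; m≤n⇒m≤1+n; m≤n+m; m<m+n
        ; +-assoc; +-comm; *-monoˡ-≤; *-monoˡ-<; m*n≢0
        ; m∸n≤m; m+[n∸m]≡n; m+n∸m≡n; m+n∸n≡m; m∸n+n≡m; [m+n]∸[m+o]≡n∸o
        ; m<n+o⇒m∸n<o; m≤n+o⇒m∸n≤o; ∸-monoʳ-≤; ∸-monoʳ-<; ∸-cancelʳ-≤ )
open import Data.Nat.DivMod using (_%_; m<n⇒m%n≡m; m≤n⇒[n∸m]%m≡n%m; [m+n]%n≡m%n; m%n≤m)
open import Data.Nat.Tactic.RingSolver using (solve-∀)
open import Data.Vec using (_∷_; here; there)
open import Data.Fin using (Fin; toℕ; fromℕ<; zero; suc)
open import Data.Fin.Properties
  using ( toℕ<n; toℕ-injective; toℕ-fromℕ<; toℕ-inject; fromℕ<-injective; suc-injective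
        ; injective⇒≤; ¬∀⟶∃¬-smallest )
open import Data.Fin.Subset using (Subset; _∈_; _∉_; ∣_∣; ∁; Nonempty; inside; outside)
open import Data.Fin.Subset.Properties using (_∈?_; nonempty?; Empty-unique; ∣⊥∣≡0; ∣∁p∣≡n∸∣p∣; x∈∁p⇒x∉p)
open import Data.Product using (∃-syntax; _×_; _,_)
open import Data.Sum using (_⊎_; inj₁; inj₂)
open import Data.Empty using (⊥; ⊥-elim)
open import Function.Definitions using (Injective)
open import Relation.Nullary using (¬_; yes; no; ¬?)
open import Relation.Nullary.Decidable using (decidable-stable)
open import Relation.Binary.PropositionalEquality

enumerate : ∀ {n} (p : Subset n) → Fin ∣ p ∣ → Fin n
enumerate (inside ∷ p) zero = zero
enumerate (inside ∷ p) (suc i) = suc (enumerate p i)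
enumerate (outside ∷ p) i = suc (enumerate p i)

enumerate-∈ : ∀ {n} (p : Subset n) (i : Fin ∣ p ∣) → enumerate p i ∈ p
enumerate-∈ (inside ∷ p) zero = here
enumerate-∈ (inside ∷ p) (suc i) = there (enumerate-∈ p i)
enumerate-∈ (outside ∷ p) i = there (enumerate-∈ p i)

enumerate-injective : ∀ {n} (p : Subset n) → Injective _≡_ _≡_ (enumerate p)
enumerate-injective (inside ∷ p) {zero} {zero} _ = refl
enumerate-injective (inside ∷ p) {suc i} {suc j} eq =
  cong suc (enumerate-injective p (suc-injective eq))
enumerate-injective (outside ∷ p) eq = enumerate-injective p (suc-injective eq)

injectiveOn⇒∣p∣≤ : ∀ {n m} (p : Subset n) (f : Fin n → ℕ) →
  (∀ {x} → x ∈ p → f x < m) →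
  (∀ {x y} → x ∈ p → y ∈ p → f x ≡ f y → x ≡ y) →
  ∣ p ∣ ≤ m
injectiveOn⇒∣p∣≤ {m = m} p f bounded injectiveOn = injective⇒≤ g-injective
  where
  g : Fin ∣ p ∣ → Fin m
  g i = fromℕ< (bounded (enumerate-∈ p i))

  g-injective : Injective _≡_ _≡_ g
  g-injective {i} {j} eq = enumerate-injective p
    (injectiveOn (enumerate-∈ p i) (enumerate-∈ p j) (fromℕ<-injective _ _ _ _ eq))

nonempty⇒∃-least : ∀ {n} (p : Subset n) → Nonempty p →
  ∃[ m ] (m ∈ p × ∀ {y} → y ∈ p → toℕ m ≤ toℕ y)
nonempty⇒∃-least p (x , x∈p)
  with ¬∀⟶∃¬-smallest _ (_∉ p) (λ y → ¬? (y ∈? p)) (λ all∉p → all∉p x x∈p)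
... | m , ¬m∉p , below-m∉p = m , decidable-stable (m ∈? p) ¬m∉p , least
  where
  least : ∀ {y} → y ∈ p → toℕ m ≤ toℕ y
  least {y} y∈p = ≮⇒≥ λ y<m →
    below-m∉p (fromℕ< y<m)
      (subst (_∈ p) (sym (toℕ-injective (trans (toℕ-inject _) (toℕ-fromℕ< y<m)))) y∈p)

m%n≡m∸n : ∀ {m n} .{{_ : NonZero n}} → n ≤ m → m < n + n → m % n ≡ m ∸ n
m%n≡m∸n {m} {n} n≤m m<2n = begin
  m % n        ≡⟨ m≤n⇒[n∸m]%m≡n%m n≤m ⟨
  (m ∸ n) % n  ≡⟨ m<n⇒m%n≡m (m<n+o⇒m∸n<o m n m<2n) ⟩
  m ∸ n        ∎
  where open ≡-Reasoning

m≡m%n+n : ∀ {m n} .{{_ : NonZero n}} → n ≤ m → m < n + n → m ≡ m % n + n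
m≡m%n+n n≤m m<2n = trans (sym (m∸n+n≡m n≤m)) (cong (_+ _) (sym (m%n≡m∸n n≤m m<2n)))

%-collision : ∀ {a b c} .{{_ : NonZero c}} → a < c + c → b < c + c →
  a % c ≡ b % c → a ≡ b ⊎ b ≡ a + c ⊎ a ≡ b + c
%-collision {a} {b} {c} a<2c b<2c a≡b with a <? c | b <? c
... | yes a<c | yes b<c = inj₁ (trans (sym (m<n⇒m%n≡m a<c)) (trans a≡b (m<n⇒m%n≡m b<c)))
... | yes a<c | no b≮c  =
  inj₂ (inj₁ (trans (m≡m%n+n (≮⇒≥ b≮c) b<2c) (cong (_+ c) (trans (sym a≡b) (m<n⇒m%n≡m a<c)))))
... | no a≮c  | yes b<c =
  inj₂ (inj₂ (trans (m≡m%n+n (≮⇒≥ a≮c) a<2c) (cong (_+ c) (trans a≡b (m<n⇒m%n≡m b<c)))))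
... | no a≮c  | no b≮c  =
  inj₁ (trans (m≡m%n+n (≮⇒≥ a≮c) a<2c) (trans (cong (_+ c) a≡b) (sym (m≡m%n+n (≮⇒≥ b≮c) b<2c))))

diffMod-forward : ∀ {n} .{{_ : NonZero n}} {x y : Fin n} {e} →
  toℕ y ≡ toℕ x + e → diffMod n y x ≡ e
diffMod-forward {n} {x} {y} {e} y≡x+e = begin
  (toℕ y + n ∸ toℕ x) % n      ≡⟨ cong (λ v → (v + n ∸ toℕ x) % n) y≡x+e ⟩
  (toℕ x + e + n ∸ toℕ x) % n  ≡⟨ cong (λ v → (v ∸ toℕ x) % n) (+-assoc (toℕ x) e n) ⟩
  (toℕ x + (e + n) ∸ toℕ x) % n ≡⟨ cong (_% n) (m+n∸m≡n (toℕ x) (e + n)) ⟩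
  (e + n) % n                  ≡⟨ [m+n]%n≡m%n e n ⟩
  e % n                        ≡⟨ m<n⇒m%n≡m e<n ⟩
  e                            ∎
  where
  open ≡-Reasoning
  e<n : e < n
  e<n = ≤-<-trans (m≤n+m e (toℕ x)) (subst (_< n) y≡x+e (toℕ<n y))

diffMod-backward : ∀ {n} .{{_ : NonZero n}} {x y : Fin n} {e} →
  toℕ y ≡ toℕ x + e → 0 < e → diffMod n x y ≡ n ∸ e
diffMod-backward {n} {x} {y} {e} y≡x+e 0<e = begin
  (toℕ x + n ∸ toℕ y) % n        ≡⟨ cong (λ v → (toℕ x + n ∸ v) % n) y≡x+e ⟩
  (toℕ x + n ∸ (toℕ x + e)) % n  ≡⟨ cong (_% n) ([m+n]∸[m+o]≡n∸o (toℕ x) n e) ⟩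
  (n ∸ e) % n                    ≡⟨ m<n⇒m%n≡m (∸-monoʳ-< 0<e e≤n) ⟩
  n ∸ e                          ∎
  where
  open ≡-Reasoning
  e≤n : e ≤ n
  e≤n = ≤-trans (m≤n+m e (toℕ x)) (subst (_≤ n) y≡x+e (<⇒≤ (toℕ<n y)))

Independent : ∀ {n} → (Fin n → Fin n → Set) → Subset n → Set
Independent Adj I = ∀ {x y} → x ∈ I → y ∈ I → ¬ Adj x y

vertexCover⇒∁-independent : ∀ {n} {Adj : Fin n → Fin n → Set} {K : Subset n} →
  IsVertexCover Adj K → Independent Adj (∁ K)
vertexCover⇒∁-independent cover x∈∁K y∈∁K adj with cover _ _ adj
... | inj₁ x∈K = x∈∁p⇒x∉p x∈∁K x∈K
... | inj₂ y∈K = x∈∁p⇒x∉p y∈∁K y∈K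

module _ (s : ℕ) .{{_ : NonZero s}} where

  private
    n : ℕ
    n = suc (6 * s)

    instance
      4s-nonZero : NonZero (4 * s)
      4s-nonZero = m*n≢0 4 s

  n∸4s≡2s+1 : n ∸ 4 * s ≡ 2 * s + 1
  n∸4s≡2s+1 = trans (cong (_∸ 4 * s) (n≡ s)) (m+n∸n≡m (2 * s + 1) (4 * s))
    where
    n≡ : ∀ s → suc (6 * s) ≡ 2 * s + 1 + 4 * s
    n≡ = solve-∀

  n∸[1+3s]≡3s : n ∸ suc (3 * s) ≡ 3 * s
  n∸[1+3s]≡3s = trans (cong (_∸ suc (3 * s)) (n≡ s)) (m+n∸n≡m (3 * s) (suc (3 * s)))
    where
    n≡ : ∀ s → suc (6 * s) ≡ 3 * s + suc (3 * s)
    n≡ = solve-∀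

  gap-adjacent : ∀ {x y : Fin n} {e} → toℕ y ≡ toℕ x + e →
    2 * s < e → e ≤ 4 * s → CircleAdj n (Interval s) x y
  gap-adjacent {e = e} y≡x+e 2s<e e≤4s with e ≤? 3 * s
  ... | yes e≤3s = inj₂ (subst (Interval s) (sym (diffMod-forward y≡x+e)) (2s+1≤e , e≤3s))
    where
    2s+1≤e : 2 * s + 1 ≤ e
    2s+1≤e = subst (_≤ e) (+-comm 1 (2 * s)) 2s<e
  ... | no e≰3s = inj₁ (subst (Interval s) (sym (diffMod-backward y≡x+e 0<e)) (lower , upper))
    where
    0<e : 0 < e
    0<e = ≤-<-trans z≤n 2s<e
    lower : 2 * s + 1 ≤ n ∸ e
    lower = subst (_≤ n ∸ e) n∸4s≡2s+1 (∸-monoʳ-≤ n e≤4s)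
    upper : n ∸ e ≤ 3 * s
    upper = subst (n ∸ e ≤_) n∸[1+3s]≡3s (∸-monoʳ-≤ n (≰⇒> e≰3s))

  independent-no-gap : ∀ {I : Subset n} → Independent (CircleAdj n (Interval s)) I →
    ∀ {x y e} → x ∈ I → y ∈ I → toℕ y ≡ toℕ x + e → 2 * s < e → e ≤ 4 * s → ⊥
  independent-no-gap independent x∈I y∈I y≡x+e 2s<e e≤4s =
    independent x∈I y∈I (gap-adjacent y≡x+e 2s<e e≤4s)

  module Offsets (I : Subset n) (independent : Independent (CircleAdj n (Interval s)) I)
    (m : Fin n) (m∈I : m ∈ I) (least : ∀ {y} → y ∈ I → toℕ m ≤ toℕ y) where

    offset : Fin n → ℕ
    offset y = toℕ y ∸ toℕ m

    reduced : Fin n → ℕ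
    reduced y = offset y % (4 * s)

    toℕ≡m+offset : ∀ {y} → y ∈ I → toℕ y ≡ toℕ m + offset y
    toℕ≡m+offset y∈I = sym (m+[n∸m]≡n (least y∈I))

    offset≤6s : ∀ y → offset y ≤ 6 * s
    offset≤6s y = ≤-trans (m∸n≤m (toℕ y) (toℕ m)) (≤-pred (toℕ<n y))

    offset<8s : ∀ y → offset y < 4 * s + 4 * s
    offset<8s y = ≤-<-trans (offset≤6s y)
      (subst (6 * s <_) (8s≡4s+4s s) (*-monoˡ-< s (≤ᵇ⇒≤ 7 8 _)))
      where
      8s≡4s+4s : ∀ s → 8 * s ≡ 4 * s + 4 * s
      8s≡4s+4s = solve-∀

    offset-small-or-large : ∀ {y} → y ∈ I → offset y ≤ 2 * s ⊎ 4 * s < offset y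
    offset-small-or-large {y} y∈I with offset y ≤? 2 * s | offset y ≤? 4 * s
    ... | yes small | _ = inj₁ small
    ... | no _ | no large = inj₂ (≰⇒> large)
    ... | no middle | yes ≤4s =
      ⊥-elim (independent-no-gap independent m∈I y∈I (toℕ≡m+offset y∈I) (≰⇒> middle) ≤4s)

    reduced<2s+1 : ∀ {y} → y ∈ I → reduced y < 2 * s + 1
    reduced<2s+1 {y} y∈I = ≤-<-trans reduced≤2s (m<m+n (2 * s) z<s)
      where
      open ≤-Reasoning
      6s≡4s+2s : ∀ s → 6 * s ≡ 4 * s + 2 * s
      6s≡4s+2s = solve-∀
      reduced≤2s : reduced y ≤ 2 * s
      reduced≤2s with offset-small-or-large y∈I
      ... | inj₁ small = ≤-trans (m%n≤m (offset y) (4 * s)) small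
      ... | inj₂ large = begin
        reduced y         ≡⟨ m%n≡m∸n (<⇒≤ large) (offset<8s y) ⟩
        offset y ∸ 4 * s  ≤⟨ m≤n+o⇒m∸n≤o (offset y) (4 * s)
                               (subst (offset y ≤_) (6s≡4s+2s s) (offset≤6s y)) ⟩
        2 * s             ∎

    no-4s-apart : ∀ {x y} → x ∈ I → y ∈ I → offset y ≡ offset x + 4 * s → ⊥
    no-4s-apart {x} {y} x∈I y∈I y-ahead =
      independent-no-gap independent x∈I y∈I y≡x+4s (*-monoˡ-< s (≤ᵇ⇒≤ 3 4 _)) ≤-refl
      where
      open ≡-Reasoning
      y≡x+4s : toℕ y ≡ toℕ x + 4 * s
      y≡x+4s = begin
        toℕ y                      ≡⟨ toℕ≡m+offset y∈I ⟩
        toℕ m + offset y           ≡⟨ cong (toℕ m +_) y-ahead ⟩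
        toℕ m + (offset x + 4 * s) ≡⟨ +-assoc (toℕ m) (offset x) (4 * s) ⟨
        toℕ m + offset x + 4 * s   ≡⟨ cong (_+ 4 * s) (toℕ≡m+offset x∈I) ⟨
        toℕ x + 4 * s              ∎

    reduced-injective : ∀ {x y} → x ∈ I → y ∈ I → reduced x ≡ reduced y → x ≡ y
    reduced-injective {x} {y} x∈I y∈I eq
      with %-collision {c = 4 * s} (offset<8s x) (offset<8s y) eq
    ... | inj₁ same = toℕ-injective
      (trans (toℕ≡m+offset x∈I) (trans (cong (toℕ m +_) same) (sym (toℕ≡m+offset y∈I))))
    ... | inj₂ (inj₁ y-ahead) = ⊥-elim (no-4s-apart x∈I y∈I y-ahead)
    ... | inj₂ (inj₂ x-ahead) = ⊥-elim (no-4s-apart y∈I x∈I x-ahead)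

  independent⇒∣I∣≤2s+1 : (I : Subset n) → Independent (CircleAdj n (Interval s)) I →
    ∣ I ∣ ≤ 2 * s + 1
  independent⇒∣I∣≤2s+1 I independent with nonempty? I
  ... | no empty =
    subst (_≤ 2 * s + 1) (sym (trans (cong ∣_∣ (Empty-unique empty)) (∣⊥∣≡0 n))) z≤n
  ... | yes nonempty with nonempty⇒∃-least I nonempty
  ... | m , m∈I , least = injectiveOn⇒∣p∣≤ I reduced reduced<2s+1 reduced-injective
    where open Offsets I independent m m∈I least

lemma2 : (s : ℕ) → s > 0 → (K : Subset (suc (6 * s))) →
    IsMinVertexCover (CircleAdj (suc (6 * s)) (Interval s)) K → 4 * s ≤ ∣ K ∣
lemma2 s s>0 K (cover , _) = ∸-cancelʳ-≤ 4s≤n (begin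
  suc (6 * s) ∸ ∣ K ∣  ≡⟨ ∣∁p∣≡n∸∣p∣ K ⟨
  ∣ ∁ K ∣              ≤⟨ independent⇒∣I∣≤2s+1 s (∁ K) (vertexCover⇒∁-independent cover) ⟩
  2 * s + 1            ≡⟨ n∸4s≡2s+1 s ⟨
  suc (6 * s) ∸ 4 * s  ∎)
  where
  open ≤-Reasoning
  instance
    s-nonZero : NonZero s
    s-nonZero = >-nonZero s>0
  4s≤n : 4 * s ≤ suc (6 * s)
  4s≤n = m≤n⇒m≤1+n (*-monoˡ-≤ s (≤ᵇ⇒≤ 4 6 _))
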